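{- Let $(\mathcal{Y},\eta)$ be an $(n,m)$-voltage operator, $y_0$ a flag of $\mathcal{Y}$, $L=\mathrm{Stab}_{\mathcal{C}^m}(y_0)$ and $\zeta:L\to\mathcal{C}^n$, $\zeta(\omega)=\eta(P_\omega(y_0))$. Then $(\mathcal{Y},\eta)$ preserves connectivity if and only if $\mathcal{Y}$ is connected and $\zeta$ is onto. In particular, whenever $(\mathcal{Y},\eta)$ preserves connectivity, $\zeta(\zeta^{ -1}(N))=N$ for the subgroup $N=\mathrm{Stab}_{\mathcal{C}^n}(x_0)$, where $x_0$ is a base flag of a connected $n$-premaniplex $\mathcal{X}$.
   Context: A graph may have multiple edges and semi-edges. An $n$-premaniplex is such a graph with edges coloured by $\{0,\dots,n-1\}$ so that every vertex (flag) is the starting point of exactly one dart of each colour, and whenever $|i-j|\ge2$ every alternating path of length 4 with colours $i,j$ is closed; $x^i$ is the end of the $i$-dart at $x$. $\mathcal{C}^n=\langle r_0,\dots,r_{n-1}\mid r_i^2=1,\ (r_ir_j)^2=1\ (|i-j|\ge2)\rangle$ acts on the left on flags by $r_ix=x^i$; $\mathrm{Stab}$ denotes stabilisers. For a flag $y$ of an $m$-premaniplex $\mathcal{Y}$ and $\omega\in\mathcal{C}^m$, $P_\omega(y)$ is the homotopy class of paths from $y$ whose successive colours $i_1,\dots,i_k$ satisfy $r_{i_k}\cdots r_{i_1}=\omega$ (homotopic iff same start and same element of $\mathcal{C}^m$); they end at $\omega y$; these form the fundamental groupoid $\Pi(\mathcal{Y})$. A voltage assignment $\eta:\Pi(\mathcal{Y})\to\mathcal{C}^n$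 satisfies $\eta(W_1W_2)=\eta(W_2)\eta(W_1)$; $(\mathcal{Y},\eta)$ is an $(n,m)$-voltage operator. $\mathcal{X}\rtimes_\eta\mathcal{Y}$ is the $m$-premaniplex with flags $\mathcal{X}\times\mathcal{Y}$ and $(x,y)^i=(\eta(P_{r_i}(y))x,y^i)$. The operator preserves connectivity if $\mathcal{X}\rtimes_\eta\mathcal{Y}$ is connected for every connected $n$-premaniplex $\mathcal{X}$. Standing assumption: $\mathcal{Y}$ has a spanning tree (forest if disconnected) all of whose darts have trivial voltage. -}

module Defs where

open import Level using (0ℓ)
open import Data.Nat using (ℕ; _+_; _≤_)
open import Data.Fin using (Fin; toℕ)
open import Data.List using (List; []; _∷_; _++_)
open import Data.Product using (Σ; ∃; _×_; _,_)
open import Data.Sum using (_⊎_)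
open import Data.Unit using (⊤)
open import Data.Empty using (⊥)
open import Relation.Binary using (Setoid)
open import Relation.Binary.PropositionalEquality using (_≡_; _≢_)
open import Function.Bundles using (_⇔_)

-- The Coxeter group C^n, presented by words modulo its relations.
-- A word is a list of colours in PATH ORDER: the list [i₁,…,i_k]
-- represents the group element r_{i_k} ⋯ r_{i₁}.  Hence the element
-- of (a ++ b) is (element of b)·(element of a).

Word : ℕ → Set
Word n = List (Fin n)

FarApart : ∀ {n} → Fin n → Fin n → Set
FarApart i j = (2 + toℕ i ≤ toℕ j) ⊎ (2 + toℕ j ≤ toℕ i)

data _≈C_ {n : ℕ} : Word n → Word n → Set where
  ≈C-refl  : ∀ {a} → a ≈C a
  ≈C-sym   : ∀ {a b} → a ≈C b → b ≈C a
  ≈C-trans : ∀ {a b c} → a ≈C b → b ≈C c → a ≈C c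
  ≈C-cong  : ∀ a {b c} d → b ≈C c → (a ++ (b ++ d)) ≈C (a ++ (c ++ d))
  ≈C-inv   : ∀ i → (i ∷ i ∷ []) ≈C []
  ≈C-comm  : ∀ i j → FarApart i j → (i ∷ j ∷ i ∷ j ∷ []) ≈C []

infix 4 _≈C_

record Premaniplex (n : ℕ) : Set₁ where
  field
    FlagS : Setoid 0ℓ 0ℓ
  open Setoid FlagS public renaming (Carrier to Flag; _≈_ to _≈F_)
  field
    r       : Fin n → Flag → Flag
    r-cong  : ∀ i {x y} → x ≈F y → r i x ≈F r i y
    r-invol : ∀ i x → r i (r i x) ≈F x
    r-comm  : ∀ i j → FarApart i j → ∀ x → r j (r i (r j (r i x))) ≈F x

  act : Word n → Flag → Flag
  act []      x = x
  act (i ∷ w) x = act w (r i x)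

  InStab : Flag → Word n → Set
  InStab x ω = act ω x ≈F x

Connected : ∀ {n} → Premaniplex n → Set
Connected X = ∀ x y → ∃ λ (w : Word _) → act w x ≈F y
  where open Premaniplex X

-- The homotopy class P_ω(y) is determined by
-- (y, ω); we represent ω by any word (path) and require η to be
-- well defined on classes.  η(W₁W₂) = η(W₂)η(W₁) reads, in path-order
-- words, η y (w₁ ++ w₂) ≈ η y w₁ ++ η (w₁ y) w₂.

record VoltageOperator (n m : ℕ) : Set₁ where
  field
    Y : Premaniplex m
  open Premaniplex Y public
  field
    η          : Flag → Word m → Word n
    η-cong-flag : ∀ {y y'} w → y ≈F y' → η y w ≈C η y' w
    η-cong-word : ∀ y {w w'} → w ≈C w' → η y w ≈C η y w'
    η-hom       : ∀ y w₁ w₂ → η y (w₁ ++ w₂) ≈C (η y w₁ ++ η (act w₁ y) w₂)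

module _ {n m : ℕ} (V : VoltageOperator n m) where
  private module V = VoltageOperator V

  AlongT : (V.Flag → Fin m → Set) → V.Flag → Word m → Set
  AlongT T y []      = ⊤
  AlongT T y (i ∷ w) = T y i × AlongT T (V.r i y) w

  -- non-backtracking: the reverse of dart (y,i) is (y^i,i)
  Reduced : Word m → Set
  Reduced []           = ⊤
  Reduced (i ∷ [])     = ⊤
  Reduced (i ∷ j ∷ w)  = (i ≢ j) × Reduced (j ∷ w)

  record TrivialSpanningForest : Set₁ where
    field
      T        : V.Flag → Fin m → Set
      T-resp   : ∀ {y y'} i → y V.≈F y' → T y i → T y' i
      T-sym    : ∀ y i → T y i → T (V.r i y) i
      T-triv   : ∀ y i → T y i → V.η y (i ∷ []) ≈C []
      T-span   : ∀ y y' (w : Word m) → V.act w y V.≈F y' →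
                 ∃ λ (w' : Word m) → AlongT T y w' × V.act w' y V.≈F y'
      T-acyclic : ∀ y (w : Word m) → w ≢ [] → Reduced w → AlongT T y w →
                  V.act w y V.≈F y → ⊥

  module _ (X : Premaniplex n) where
    private module X = Premaniplex X

    ProdFlag : Set
    ProdFlag = X.Flag × V.Flag

    _≈P_ : ProdFlag → ProdFlag → Set
    (x , y) ≈P (x' , y') = (x X.≈F x') × (y V.≈F y')

    prodR : Fin m → ProdFlag → ProdFlag
    prodR i (x , y) = X.act (V.η y (i ∷ [])) x , V.r i y

    prodAct : Word m → ProdFlag → ProdFlag
    prodAct []      p = p
    prodAct (i ∷ w) p = prodAct w (prodR i p)

    ProdConnected : Set
    ProdConnected = ∀ p q → ∃ λ (w : Word m) → prodAct w p ≈P q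

  PreservesConnectivity : Set₁
  PreservesConnectivity = (X : Premaniplex n) → Connected X → ProdConnected X

  ζ : V.Flag → Word m → Word n
  ζ y₀ ω = V.η y₀ ω

  ZetaOnto : V.Flag → Set
  ZetaOnto y₀ = ∀ (ν : Word n) → ∃ λ (ω : Word m) → V.InStab y₀ ω × ζ y₀ ω ≈C ν

{-# OPTIONS --safe #-}
-- If X ⋊ Y is connected for every connected X, take X to be the one-flag
-- premaniplex (so Y is connected) and X = C^n acting on itself (then reaching
-- (ν , y₀) from (1 , y₀) needs a loop at y₀ of voltage ν).  Conversely, from
-- any (x , y) one walks along Y into the fibre over y₀, moves inside that
-- fibre by loops at y₀, which realise every element of C^n and hence connect
-- the fibre since X is connected, and finally leaves it along a path to the
-- target; the start of the last leg is chosen as the preimage of the target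
-- under that path's voltage.
module Submission where

open import Defs
open import Data.Nat using (ℕ)
open import Data.List using ([]; _∷_; _++_; _∷ʳ_; foldl; reverse)
open import Data.List.Properties
  using (++-assoc; ++-identityʳ; unfold-reverse; reverse-involutive)
open import Data.Product using (∃; _×_; _,_; proj₁; proj₂)
open import Data.Unit using (⊤; tt)
open import Function.Bundles using (_⇔_; mk⇔)
open import Relation.Binary using (Setoid)
open import Relation.Binary.PropositionalEquality as ≡ using (_≡_)
import Relation.Binary.Reasoning.Setoid as SetoidReasoning

≡⇒≈C : ∀ {n} {a b : Word n} → a ≡ b → a ≈C b
≡⇒≈C ≡.refl = ≈C-refl

C-setoid : ℕ → Setoid _ _
C-setoid n = record
  { Carrier       = Word n
  ; _≈_           = _≈C_
  ; isEquivalence = record { refl = ≈C-refl ; sym = ≈C-sym ; trans = ≈C-trans }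
  }

module _ {n : ℕ} where
  open SetoidReasoning (C-setoid n)

  ++-congʳ : ∀ d {b c : Word n} → b ≈C c → b ++ d ≈C c ++ d
  ++-congʳ d = ≈C-cong [] d

  ++-congˡ : ∀ a {b c : Word n} → b ≈C c → a ++ b ≈C a ++ c
  ++-congˡ a {b} {c} b≈c = begin
    a ++ b         ≡⟨ ≡.cong (a ++_) (++-identityʳ b) ⟨
    a ++ (b ++ []) ≈⟨ ≈C-cong a [] b≈c ⟩
    a ++ (c ++ []) ≡⟨ ≡.cong (a ++_) (++-identityʳ c) ⟩
    a ++ c         ∎

  ++-trivialʳ : ∀ a {b : Word n} → b ≈C [] → a ++ b ≈C a
  ++-trivialʳ a {b} b≈[] = begin
    a ++ b  ≈⟨ ++-congˡ a b≈[] ⟩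
    a ++ [] ≡⟨ ++-identityʳ a ⟩
    a       ∎

  reverse-inverseˡ : ∀ (w : Word n) → reverse w ++ w ≈C []
  reverse-inverseˡ []      = ≈C-refl
  reverse-inverseˡ (i ∷ w) = begin
    reverse (i ∷ w) ++ i ∷ w     ≡⟨ ≡.cong (_++ i ∷ w) (unfold-reverse i w) ⟩
    (reverse w ∷ʳ i) ++ i ∷ w    ≡⟨ ++-assoc (reverse w) (i ∷ []) (i ∷ w) ⟩
    reverse w ++ (i ∷ i ∷ [] ++ w) ≈⟨ ≈C-cong (reverse w) w (≈C-inv i) ⟩
    reverse w ++ w               ≈⟨ reverse-inverseˡ w ⟩
    []                           ∎

  reverse-inverseʳ : ∀ (w : Word n) → w ++ reverse w ≈C []
  reverse-inverseʳ w = begin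
    w ++ reverse w                   ≡⟨ ≡.cong (_++ reverse w) (reverse-involutive w) ⟨
    reverse (reverse w) ++ reverse w ≈⟨ reverse-inverseˡ (reverse w) ⟩
    []                               ∎

  idempotent⇒≈[] : ∀ {a : Word n} → a ++ a ≈C a → a ≈C []
  idempotent⇒≈[] {a} aa≈a = ≈C-sym (begin
    []                    ≈⟨ reverse-inverseˡ a ⟨
    reverse a ++ a        ≈⟨ ++-congˡ (reverse a) aa≈a ⟨
    reverse a ++ a ++ a   ≡⟨ ++-assoc (reverse a) a a ⟨
    (reverse a ++ a) ++ a ≈⟨ ++-congʳ a (reverse-inverseˡ a) ⟩
    a                     ∎)

module PremaniplexProperties {n : ℕ} (P : Premaniplex n) where
  open Premaniplex P public

  act-++ : ∀ a b x → act (a ++ b) x ≡ act b (act a x)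
  act-++ []      b x = ≡.refl
  act-++ (i ∷ a) b x = act-++ a b (r i x)

  act-cong-flag : ∀ w {x x′} → x ≈F x′ → act w x ≈F act w x′
  act-cong-flag []      x≈x′ = x≈x′
  act-cong-flag (i ∷ w) x≈x′ = act-cong-flag w (r-cong i x≈x′)

  act-cong-word : ∀ {w w′} → w ≈C w′ → ∀ x → act w x ≈F act w′ x
  act-cong-word ≈C-refl          x = refl
  act-cong-word (≈C-sym p)       x = sym (act-cong-word p x)
  act-cong-word (≈C-trans p q)   x = trans (act-cong-word p x) (act-cong-word q x)
  act-cong-word (≈C-cong a {b} {c} d p) x = begin
    act (a ++ b ++ d) x     ≡⟨ ≡.trans (act-++ a (b ++ d) x) (act-++ b d (act a x)) ⟩
    act d (act b (act a x)) ≈⟨ act-cong-flag d (act-cong-word p (act a x)) ⟩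
    act d (act c (act a x)) ≡⟨ ≡.trans (act-++ a (c ++ d) x) (act-++ c d (act a x)) ⟨
    act (a ++ c ++ d) x     ∎
    where open SetoidReasoning FlagS
  act-cong-word (≈C-inv i)       x = r-invol i x
  act-cong-word (≈C-comm i j ij) x = r-comm i j ij x

  act-reverse-cancel : ∀ w x → act w (act (reverse w) x) ≈F x
  act-reverse-cancel w x = begin
    act w (act (reverse w) x) ≡⟨ act-++ (reverse w) w x ⟨
    act (reverse w ++ w) x    ≈⟨ act-cong-word (reverse-inverseˡ w) x ⟩
    x                         ∎
    where open SetoidReasoning FlagS

foldl-∷ʳ-≈ : ∀ {n} (x w : Word n) → w ≈C [] → foldl _∷ʳ_ x w ≈C x
foldl-∷ʳ-≈ x w w≈[] = ≈C-trans (≡⇒≈C (foldl-∷ʳ≡++ x w)) (++-trivialʳ x w≈[])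
  where
  foldl-∷ʳ≡++ : ∀ {n} (x w : Word n) → foldl _∷ʳ_ x w ≡ x ++ w
  foldl-∷ʳ≡++ x []      = ≡.sym (++-identityʳ x)
  foldl-∷ʳ≡++ x (i ∷ w) = ≡.trans (foldl-∷ʳ≡++ (x ∷ʳ i) w) (++-assoc x (i ∷ []) w)

universal : (n : ℕ) → Premaniplex n
universal n = record
  { FlagS   = C-setoid n
  ; r       = λ i x → x ∷ʳ i
  ; r-cong  = λ i → ++-congʳ (i ∷ [])
  ; r-invol = λ i x → foldl-∷ʳ-≈ x (i ∷ i ∷ []) (≈C-inv i)
  ; r-comm  = λ i j ij x → foldl-∷ʳ-≈ x (i ∷ j ∷ i ∷ j ∷ []) (≈C-comm i j ij)
  }

universal-act : ∀ {n} (w x : Word n) → Premaniplex.act (universal n) w x ≡ x ++ w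
universal-act []      x = ≡.sym (++-identityʳ x)
universal-act (i ∷ w) x = ≡.trans (universal-act w (x ∷ʳ i)) (++-assoc x (i ∷ []) w)

universal-connected : ∀ {n} → Connected (universal n)
universal-connected x y = reverse x ++ y , (begin
  Premaniplex.act (universal _) (reverse x ++ y) x ≡⟨ universal-act (reverse x ++ y) x ⟩
  x ++ reverse x ++ y                            ≡⟨ ++-assoc x (reverse x) y ⟨
  (x ++ reverse x) ++ y                          ≈⟨ ++-congʳ y (reverse-inverseʳ x) ⟩
  y                                              ∎)
  where open SetoidReasoning (C-setoid _)

trivial : (n : ℕ) → Premaniplex n
trivial n = record
  { FlagS   = ≡.setoid ⊤
  ; r       = λ _ x → x
  ; r-cong  = λ _ p → p
  ; r-invol = λ _ _ → ≡.refl
  ; r-comm  = λ _ _ _ _ → ≡.refl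
  }

trivial-connected : ∀ {n} → Connected (trivial n)
trivial-connected tt tt = [] , ≡.refl

module VoltageProperties {n m : ℕ} (V : VoltageOperator n m) where
  open VoltageOperator V using (η; η-hom; η-cong-flag)
  private module Y = PremaniplexProperties (VoltageOperator.Y V)

  η-[] : ∀ y → η y [] ≈C []
  η-[] y = idempotent⇒≈[] (≈C-sym (η-hom y [] []))

  InStab⇔ζ-preimage : ∀ {y₀} → ZetaOnto V y₀ → (X : Premaniplex n) →
    ∀ x₀ ν → Premaniplex.InStab X x₀ ν ⇔
      ∃ λ ω → Y.InStab y₀ ω × Premaniplex.InStab X x₀ (ζ V y₀ ω) × ζ V y₀ ω ≈C ν
  InStab⇔ζ-preimage onto X x₀ ν = mk⇔
    (λ ν∈Stab → let (ω , loop , ζω≈ν) = onto ν in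
      ω , loop , X.trans (X.act-cong-word ζω≈ν x₀) ν∈Stab , ζω≈ν)
    (λ (ω , _ , ζω∈Stab , ζω≈ν) → X.trans (X.act-cong-word (≈C-sym ζω≈ν) x₀) ζω∈Stab)
    where
    module X = PremaniplexProperties X

  module Product (X : Premaniplex n) where
    private module X = PremaniplexProperties X

    _≈⋊_ : ProdFlag V X → ProdFlag V X → Set
    _≈⋊_ = _≈P_ V X

    act⋊ : Word m → ProdFlag V X → ProdFlag V X
    act⋊ = prodAct V X

    act⋊-++ : ∀ a b p → act⋊ (a ++ b) p ≡ act⋊ b (act⋊ a p)
    act⋊-++ []      b p = ≡.refl
    act⋊-++ (i ∷ a) b p = act⋊-++ a b (prodR V X i p)

    act⋊-cong : ∀ w {p q} → p ≈⋊ q → act⋊ w p ≈⋊ act⋊ w q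
    act⋊-cong []      p≈q         = p≈q
    act⋊-cong (i ∷ w) {x , y} {x′ , y′} (x≈x′ , y≈y′) = act⋊-cong w
      ( X.trans (X.act-cong-word (η-cong-flag (i ∷ []) y≈y′) x)
                (X.act-cong-flag (η y′ (i ∷ [])) x≈x′)
      , Y.r-cong i y≈y′ )

    act⋊-≈ : ∀ w x y → act⋊ w (x , y) ≈⋊ (X.act (η y w) x , Y.act w y)
    act⋊-≈ []      x y = X.sym (X.act-cong-word (η-[] y) x) , Y.refl
    act⋊-≈ (i ∷ w) x y =
      let (x-step , y-step) = act⋊-≈ w (X.act (η y (i ∷ [])) x) (Y.r i y) in
      (begin
        proj₁ (act⋊ (i ∷ w) (x , y))                   ≈⟨ x-step ⟩
        X.act (η (Y.r i y) w) (X.act (η y (i ∷ [])) x) ≡⟨ X.act-++ (η y (i ∷ [])) _ x ⟨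
        X.act (η y (i ∷ []) ++ η (Y.r i y) w) x        ≈⟨ X.act-cong-word (η-hom y (i ∷ []) w) x ⟨
        X.act (η y (i ∷ w)) x                          ∎)
      , y-step
      where open SetoidReasoning X.FlagS

    Reach : ProdFlag V X → ProdFlag V X → Set
    Reach p q = ∃ λ w → act⋊ w p ≈⋊ q

    ≈⋊-sym : ∀ {p q} → p ≈⋊ q → q ≈⋊ p
    ≈⋊-sym (ex , ey) = X.sym ex , Y.sym ey

    ≈⋊-trans : ∀ {p q s} → p ≈⋊ q → q ≈⋊ s → p ≈⋊ s
    ≈⋊-trans (ex , ey) (ex′ , ey′) = X.trans ex ex′ , Y.trans ey ey′

    Reach-trans : ∀ {p q s} → Reach p q → Reach q s → Reach p s
    Reach-trans {p} (w₁ , e₁) (w₂ , e₂) = w₁ ++ w₂ ,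
      ≡.subst (_≈⋊ _) (≡.sym (act⋊-++ w₁ w₂ p)) (≈⋊-trans (act⋊-cong w₂ e₁) e₂)

    path⇒Reach : ∀ {x y x′ y′} w → X.act (η y w) x X.≈F x′ → Y.act w y Y.≈F y′ →
      Reach (x , y) (x′ , y′)
    path⇒Reach {x} {y} w ex ey = w , ≈⋊-trans (act⋊-≈ w x y) (ex , ey)

    Reach⇒path : ∀ {x y x′ y′} → Reach (x , y) (x′ , y′) →
      ∃ λ w → X.act (η y w) x X.≈F x′ × Y.act w y Y.≈F y′
    Reach⇒path {x} {y} (w , e) = w , ≈⋊-trans (≈⋊-sym (act⋊-≈ w x y)) e

  preservesConnectivity⇒connected : PreservesConnectivity V → Connected (VoltageOperator.Y V)
  preservesConnectivity⇒connected pc y y′ =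
    let (w , _ , ey) = Reach⇒path (pc (trivial n) trivial-connected (tt , y) (tt , y′)) in w , ey
    where open Product (trivial n)

  preservesConnectivity⇒ζ-onto : PreservesConnectivity V → ∀ y₀ → ZetaOnto V y₀
  preservesConnectivity⇒ζ-onto pc y₀ ν =
    let (w , eν , loop) = Reach⇒path (pc (universal n) universal-connected ([] , y₀) (ν , y₀))
    in w , loop , ≈C-trans (≡⇒≈C (≡.sym (universal-act (η y₀ w) []))) eν
    where open Product (universal n)

  connected∧ζ-onto⇒preservesConnectivity :
    ∀ y₀ → Connected (VoltageOperator.Y V) → ZetaOnto V y₀ → PreservesConnectivity V
  connected∧ζ-onto⇒preservesConnectivity y₀ conY onto X conX (x , y) (x′ , y′) =
    Reach-trans into-fibre (Reach-trans within-fibre out-of-fibre)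
    where
    open Product X
    module X = PremaniplexProperties X

    w₁ = proj₁ (conY y y₀)
    w₂ = proj₁ (conY y₀ y′)
    x₁ = X.act (η y w₁) x
    x₂ = X.act (reverse (η y₀ w₂)) x′

    into-fibre : Reach (x , y) (x₁ , y₀)
    into-fibre = path⇒Reach w₁ X.refl (proj₂ (conY y y₀))

    within-fibre : Reach (x₁ , y₀) (x₂ , y₀)
    within-fibre =
      let (u , eu) = conX x₁ x₂
          (ω , loop , ζω≈u) = onto u
      in path⇒Reach ω (X.trans (X.act-cong-word ζω≈u x₁) eu) loop

    out-of-fibre : Reach (x₂ , y₀) (x′ , y′)
    out-of-fibre = path⇒Reach w₂ (X.act-reverse-cancel (η y₀ w₂) x′) (proj₂ (conY y₀ y′))

corollary5p5 : ∀ {n m : ℕ} (V : VoltageOperator n m) → TrivialSpanningForest V →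
    (y₀ : VoltageOperator.Flag V) →
    (PreservesConnectivity V ⇔ (Connected (VoltageOperator.Y V) × ZetaOnto V y₀))
    × (PreservesConnectivity V → (X : Premaniplex n) → Connected X →
        (x₀ : Premaniplex.Flag X) → (ν : Word n) →
        (Premaniplex.InStab X x₀ ν ⇔
          ∃ λ (ω : Word m) → VoltageOperator.InStab V y₀ ω
            × Premaniplex.InStab X x₀ (ζ V y₀ ω) × ζ V y₀ ω ≈C ν))
corollary5p5 V _ y₀ =
  mk⇔ (λ pc → preservesConnectivity⇒connected pc , preservesConnectivity⇒ζ-onto pc y₀)
      (λ (conY , onto) → connected∧ζ-onto⇒preservesConnectivity y₀ conY onto)
  , λ pc X _ → InStab⇔ζ-preimage (preservesConnectivity⇒ζ-onto pc y₀) X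
  where open VoltageProperties V
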